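{- Let $k\geq 2$ be an integer, let $G$ be a graph with $\delta(G)\geq k-1$, and let $m\geq k$ be an integer. Then $\gamma_{\times k}^{r}(G)=m$ if and only if $m$ is the smallest positive integer $m'$ with the following property: $G$ is isomorphic to some graph $K'$ on $m'$ vertices with $\delta(K')\geq k-1$ (i.e. a spanning subgraph of $K_{m'}$ with minimum degree at least $k-1$), or $G$ is isomorphic to $F\circ_k K'$ for some graph $F$ with $\delta(F)\geq k$ and some graph $K'$ on $m'$ vertices with $\delta(K')\geq k-1$.
   Context: All graphs are finite, simple and undirected. For a graph $G=(V,E)$ and $x\in V$, $N[x]$ is the closed neighborhood. For a graph $G$ with $\delta(G)\geq k-1$: a set $S\subseteq V$ is a $k$-tuple dominating set if $|N[x]\cap S|\geq k$ for all $x\in V$; it is a $k$-tuple restrained dominating set if moreover every vertex of $V-S$ has at least $k$ neighbors in $V-S$; $\gamma_{\times k}^{r}(G)$ is the minimum cardinality of such a set. For graphs $F$ and $H$ with $|V(H)|\geq k$, a $k$-join $F\circ_k H$ is any graph obtained from the disjoint union of $F$ and $H$ by joining each vertex of $F$ to at least $k$ vertices of $H$ (no other edges are added). -}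

module Defs where

open import Data.Bool using (Bool; true; false; _∨_)
open import Data.Nat using (ℕ; _≤_; _<_; _∸_)
open import Data.Fin using (Fin; _↑ˡ_; _↑ʳ_)
open import Data.Fin.Properties using (_≟_)
open import Data.Fin.Subset using (Subset; _∈_; _∩_; ∁; ∣_∣)
open import Data.Vec using (tabulate)
open import Data.Product using (Σ; Σ-syntax; ∃; ∃-syntax; _×_)
open import Data.Sum using (_⊎_)
open import Function.Bundles using (_⤖_; Bijection)
open import Relation.Binary.PropositionalEquality using (_≡_)
open import Relation.Nullary using (does)

record Graph (n : ℕ) : Set where
  field
    adj    : Fin n → Fin n → Bool
    sym    : ∀ x y → adj x y ≡ adj y x
    irrefl : ∀ x → adj x x ≡ false
open Graph public

N : ∀ {n} → Graph n → Fin n → Subset n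
N G x = tabulate (λ y → adj G x y)

N[_] : ∀ {n} → Graph n → Fin n → Subset n
N[ G ] x = tabulate (λ y → does (x ≟ y) ∨ adj G x y)

deg : ∀ {n} → Graph n → Fin n → ℕ
deg G x = ∣ N G x ∣

MinDeg≥ : ∀ {n} → Graph n → ℕ → Set
MinDeg≥ G d = ∀ x → d ≤ deg G x

IsKTupleDom : ∀ {n} → ℕ → Graph n → Subset n → Set
IsKTupleDom k G S = ∀ x → k ≤ ∣ N[ G ] x ∩ S ∣

IsKTupleRestrainedDom : ∀ {n} → ℕ → Graph n → Subset n → Set
IsKTupleRestrainedDom k G S =
  IsKTupleDom k G S × (∀ x → x ∈ ∁ S → k ≤ ∣ N G x ∩ ∁ S ∣)

γr×[_]_≡_ : ∀ {n} → ℕ → Graph n → ℕ → Set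
γr×[ k ] G ≡ m =
  (Σ[ S ∈ Subset _ ] IsKTupleRestrainedDom k G S × ∣ S ∣ ≡ m)
  × (∀ S → IsKTupleRestrainedDom k G S → m ≤ ∣ S ∣)

_≅_ : ∀ {n n'} → Graph n → Graph n' → Set
_≅_ {n} {n'} G H =
  Σ[ f ∈ Fin n ⤖ Fin n' ] (∀ x y → adj G x y ≡ adj H (Bijection.to f x) (Bijection.to f y))

-- J (on Fin (a + b)) is a k-join F ∘_k H : the disjoint union of F (vertices i ↑ˡ b)
-- and H (vertices a ↑ʳ j), plus edges only between F and H, each vertex of F
-- joined to at least k vertices of H.  (|V(H)| ≥ k is required as in the definition.)
IsKJoin : ∀ {a b} → ℕ → Graph a → Graph b → Graph (a Data.Nat.+ b) → Set
IsKJoin {a} {b} k F H J =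
  k ≤ b
  × (∀ i i' → adj J (i ↑ˡ b) (i' ↑ˡ b) ≡ adj F i i')
  × (∀ j j' → adj J (a ↑ʳ j) (a ↑ʳ j') ≡ adj H j j')
  × (∀ i → k ≤ ∣ tabulate (λ j → adj J (i ↑ˡ b) (a ↑ʳ j)) ∣)

JoinProperty : ∀ {n} → ℕ → Graph n → ℕ → Set
JoinProperty k G m' =
  (Σ[ K' ∈ Graph m' ] MinDeg≥ K' (k ∸ 1) × G ≅ K')
  ⊎ (Σ[ a ∈ ℕ ] Σ[ F ∈ Graph a ] Σ[ K' ∈ Graph m' ] Σ[ J ∈ Graph (a Data.Nat.+ m') ]
       MinDeg≥ F k × MinDeg≥ K' (k ∸ 1) × IsKJoin k F K' J × G ≅ J)

IsLeastPositive : (ℕ → Set) → ℕ → Set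
IsLeastPositive P m = 0 < m × P m × (∀ m' → 0 < m' → P m' → m ≤ m')

module Submission where

-- A set S is a k-tuple restrained dominating set of G exactly when G, with its vertices
-- listed as V − S followed by S, is a k-join F ∘ₖ K' of F = G[V − S] and K' = G[S] with
-- δ(F) ≥ k and δ(K') ≥ k − 1: restraint of V − S is δ(F) ≥ k, domination of a vertex
-- outside S means k neighbours in S, and domination of a vertex of S counts itself, so
-- it needs only k − 1 neighbours inside S.  Conversely each alternative of the property
-- yields such a set on the K' side.  So the sizes of these sets are exactly the integers
-- with the property, and the two minima coincide.

open import Defs hiding (sym)
open import Data.Bool using (Bool; true; false; _∨_; _∧_; not; if_then_else_)
open import Data.Bool.Properties using (∧-identityʳ; ∧-zeroʳ)
open import Data.Fin using (Fin; zero; suc; _↑ˡ_; _↑ʳ_; splitAt; join; fromℕ<)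
open import Data.Fin.Properties using (_≟_; +↔⊎; splitAt-↑ˡ; splitAt-↑ʳ; splitAt⁻¹-↑ˡ; splitAt⁻¹-↑ʳ; splitAt-join; ↑ʳ-injective)
open import Data.Fin.Subset using (Subset; _∈_; _∩_; ∁; ∣_∣; inside; outside)
open import Data.Fin.Subset.Properties using (∣p∩q∣≤∣q∣; ∣p∣≤n)
open import Data.Nat using (ℕ; zero; suc; _+_; _≤_; _<_; _∸_; z≤n; s≤s)
open import Data.Nat.Properties using (+-0-commutativeMonoid; ≤-trans; <-≤-trans; ≤-reflexive; +-identityʳ; m≤n+m∸n; ∸-monoˡ-≤; module ≤-Reasoning)
open import Data.Product using (Σ-syntax; _×_; _,_; proj₁)
open import Data.Sum using (_⊎_; inj₁; inj₂; map₁; map₂)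
open import Data.Vec using ([]; _∷_; tabulate; lookup; here; there)
open import Data.Vec.Properties using (lookup∘tabulate; lookup-map; tabulate-cong)
open import Function using (_∘_; const)
open import Function.Definitions using (Injective)
open import Function.Bundles using (_⤖_; _↔_; _⇔_; Bijection; Inverse; mk↔ₛ′; mk⇔; Equivalence)
open import Function.Properties.Bijection using (⤖⇒↔)
open import Function.Properties.Inverse using (↔⇒⤖; ↔-sym; ↔-trans)
open import Relation.Binary.PropositionalEquality
  using (_≡_; _≢_; _≗_; refl; sym; trans; cong; cong₂; subst; module ≡-Reasoning)
open import Relation.Nullary using (does; yes; no; contradiction)
open import Relation.Nullary.Decidable using (dec-true; dec-false)
open import Algebra.Properties.CommutativeMonoid.Sum +-0-commutativeMonoid using (sum; sum-permute)

private
  variable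
    a b m n : ℕ

count : (Fin n → Bool) → ℕ
count p = ∣ tabulate p ∣

count-cong : {p q : Fin n → Bool} → p ≗ q → count p ≡ count q
count-cong = cong ∣_∣ ∘ tabulate-cong

count≡sum : (p : Fin n → Bool) → count p ≡ sum (λ i → if p i then 1 else 0)
count≡sum {zero}  p = refl
count≡sum {suc n} p with p zero
... | true  = cong suc (count≡sum (p ∘ suc))
... | false = count≡sum (p ∘ suc)

count-∘⤖ : (f : Fin n ⤖ Fin m) (p : Fin m → Bool) → count (p ∘ Bijection.to f) ≡ count p
count-∘⤖ f p = begin
  count (p ∘ Bijection.to f)                          ≡⟨ count≡sum (p ∘ Bijection.to f) ⟩
  sum (λ x → if p (Bijection.to f x) then 1 else 0) ≡⟨ sum-permute (λ y → if p y then 1 else 0) (⤖⇒↔ f) ⟨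
  sum (λ y → if p y then 1 else 0)                  ≡⟨ count≡sum p ⟨
  count p                                             ∎
  where open ≡-Reasoning

count-∀false : (p : Fin n → Bool) → (∀ i → p i ≡ false) → count p ≡ 0
count-∀false {zero}  p _ = refl
count-∀false {suc n} p all with p zero | all zero
... | false | _ = count-∀false (p ∘ suc) (all ∘ suc)

count-∀true : (p : Fin n → Bool) → (∀ i → p i ≡ true) → count p ≡ n
count-∀true {zero}  p _ = refl
count-∀true {suc n} p all with p zero | all zero
... | true | _ = cong suc (count-∀true (p ∘ suc) (all ∘ suc))

count-+ : ∀ a (p : Fin (a + b) → Bool) → count p ≡ count (p ∘ (_↑ˡ b)) + count (p ∘ (a ↑ʳ_))
count-+ zero    p = refl
count-+ (suc a) p with p zero
... | true  = cong suc (count-+ a (p ∘ suc))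
... | false = count-+ a (p ∘ suc)

count-insert : (x : Fin n) (p : Fin n → Bool) → p x ≡ false →
               count (λ y → does (x ≟ y) ∨ p y) ≡ suc (count p)
count-insert zero    p px with p zero
... | false = refl
count-insert (suc x) p px with p zero
... | true  = cong suc (count-insert x (p ∘ suc) px)
... | false = count-insert x (p ∘ suc) px

∣tabulate∩∣ : (p : Fin n → Bool) (S : Subset n) → ∣ tabulate p ∩ S ∣ ≡ count (λ y → p y ∧ lookup S y)
∣tabulate∩∣ p []      = refl
∣tabulate∩∣ p (s ∷ S) with p zero ∧ s
... | true  = cong suc (∣tabulate∩∣ (p ∘ suc) S)
... | false = ∣tabulate∩∣ (p ∘ suc) S

x∈∁S⇔S[x]≡false : (x : Fin n) (S : Subset n) → x ∈ ∁ S ⇔ lookup S x ≡ false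
x∈∁S⇔S[x]≡false x S = mk⇔ (to x S) (from x S)
  where
  to : (x : Fin n) (S : Subset n) → x ∈ ∁ S → lookup S x ≡ false
  to zero    (outside ∷ S) _         = refl
  to (suc x) (_ ∷ S)       (there m) = to x S m
  from : (x : Fin n) (S : Subset n) → lookup S x ≡ false → x ∈ ∁ S
  from zero    (outside ∷ S) _ = here
  from (suc x) (_ ∷ S)       e = there (from x S e)

isInj₂ᵇ : {A B : Set} → A ⊎ B → Bool
isInj₂ᵇ (inj₁ _) = false
isInj₂ᵇ (inj₂ _) = true

separate : (S : Subset n) → Fin n → Fin ∣ ∁ S ∣ ⊎ Fin ∣ S ∣
separate (inside  ∷ S) zero    = inj₂ zero
separate (inside  ∷ S) (suc x) = map₂ suc (separate S x)
separate (outside ∷ S) zero    = inj₁ zero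
separate (outside ∷ S) (suc x) = map₁ suc (separate S x)

merge : (S : Subset n) → Fin ∣ ∁ S ∣ ⊎ Fin ∣ S ∣ → Fin n
merge (inside  ∷ S) (inj₁ i)       = suc (merge S (inj₁ i))
merge (inside  ∷ S) (inj₂ zero)    = zero
merge (inside  ∷ S) (inj₂ (suc j)) = suc (merge S (inj₂ j))
merge (outside ∷ S) (inj₁ zero)    = zero
merge (outside ∷ S) (inj₁ (suc i)) = suc (merge S (inj₁ i))
merge (outside ∷ S) (inj₂ j)       = suc (merge S (inj₂ j))

merge∘separate : (S : Subset n) → ∀ x → merge S (separate S x) ≡ x
merge∘separate (inside  ∷ S) zero = refl
merge∘separate (outside ∷ S) zero = refl
merge∘separate (inside ∷ S) (suc x) with separate S x | merge∘separate S x
... | inj₁ _ | e = cong suc e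
... | inj₂ _ | e = cong suc e
merge∘separate (outside ∷ S) (suc x) with separate S x | merge∘separate S x
... | inj₁ _ | e = cong suc e
... | inj₂ _ | e = cong suc e

separate∘merge : (S : Subset n) → ∀ y → separate S (merge S y) ≡ y
separate∘merge (inside  ∷ S) (inj₁ i)       = cong (map₂ suc) (separate∘merge S (inj₁ i))
separate∘merge (inside  ∷ S) (inj₂ zero)    = refl
separate∘merge (inside  ∷ S) (inj₂ (suc j)) = cong (map₂ suc) (separate∘merge S (inj₂ j))
separate∘merge (outside ∷ S) (inj₁ zero)    = refl
separate∘merge (outside ∷ S) (inj₁ (suc i)) = cong (map₁ suc) (separate∘merge S (inj₁ i))
separate∘merge (outside ∷ S) (inj₂ j)       = cong (map₁ suc) (separate∘merge S (inj₂ j))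

isInj₂ᵇ∘separate : (S : Subset n) → ∀ x → isInj₂ᵇ (separate S x) ≡ lookup S x
isInj₂ᵇ∘separate (inside  ∷ S) zero = refl
isInj₂ᵇ∘separate (outside ∷ S) zero = refl
isInj₂ᵇ∘separate (inside ∷ S) (suc x) with separate S x | isInj₂ᵇ∘separate S x
... | inj₁ _ | e = e
... | inj₂ _ | e = e
isInj₂ᵇ∘separate (outside ∷ S) (suc x) with separate S x | isInj₂ᵇ∘separate S x
... | inj₁ _ | e = e
... | inj₂ _ | e = e

partition : (S : Subset n) → Fin n ↔ (Fin ∣ ∁ S ∣ ⊎ Fin ∣ S ∣)
partition S = mk↔ₛ′ (separate S) (merge S) (separate∘merge S) (merge∘separate S)

closedAdj : Graph n → Fin n → Fin n → Bool
closedAdj G x y = does (x ≟ y) ∨ adj G x y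

∣N[x]∣≡1+deg : (G : Graph n) (x : Fin n) → count (closedAdj G x) ≡ suc (deg G x)
∣N[x]∣≡1+deg G x = count-insert x (adj G x) (irrefl G x)

does-≟-injective : (f : Fin n → Fin m) → Injective _≡_ _≡_ f → ∀ x y → does (f x ≟ f y) ≡ does (x ≟ y)
does-≟-injective f f-inj x y with x ≟ y
... | yes refl = dec-true (f x ≟ f x) refl
... | no x≢y   = dec-false (f x ≟ f y) (x≢y ∘ f-inj)

MinDeg≥-cong : ∀ {d} (G H : Graph n) → (∀ x y → adj G x y ≡ adj H x y) → MinDeg≥ H d → MinDeg≥ G d
MinDeg≥-cong G H G≗H δH x = ≤-trans (δH x) (≤-reflexive (count-cong (sym ∘ G≗H x)))

IsKTupleRestrainedDomᵇ : ℕ → Graph n → (Fin n → Bool) → Set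
IsKTupleRestrainedDomᵇ k G s =
  (∀ x → k ≤ count (λ y → closedAdj G x y ∧ s y))
  × (∀ x → s x ≡ false → k ≤ count (λ y → adj G x y ∧ not (s y)))

restrained⇔restrainedᵇ : ∀ {k} (G : Graph n) (S : Subset n) →
                         IsKTupleRestrainedDom k G S ⇔ IsKTupleRestrainedDomᵇ k G (lookup S)
restrained⇔restrainedᵇ {k = k} G S = mk⇔
  (λ (dom , res) → (λ x → ≤-trans (dom x) (≤-reflexive (dom≡ x)))
                 , (λ x Sx → ≤-trans (res x (Equivalence.from (x∈∁S⇔S[x]≡false x S) Sx)) (≤-reflexive (res≡ x))))
  (λ (dom , res) → (λ x → ≤-trans (dom x) (≤-reflexive (sym (dom≡ x))))
                 , (λ x x∉S → ≤-trans (res x (Equivalence.to (x∈∁S⇔S[x]≡false x S) x∉S)) (≤-reflexive (sym (res≡ x)))))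
  where
  dom≡ : ∀ x → ∣ N[ G ] x ∩ S ∣ ≡ count (λ y → closedAdj G x y ∧ lookup S y)
  dom≡ x = ∣tabulate∩∣ (closedAdj G x) S
  res≡ : ∀ x → ∣ N G x ∩ ∁ S ∣ ≡ count (λ y → adj G x y ∧ not (lookup S y))
  res≡ x = trans (∣tabulate∩∣ (adj G x) (∁ S)) (count-cong λ y → cong (adj G x y ∧_) (lookup-map y not S))

restrainedᵇ-transport : ∀ {k} (G : Graph n) (H : Graph m) (iso : G ≅ H) {s : Fin n → Bool} {h : Fin m → Bool} →
                        (∀ x → s x ≡ h (Bijection.to (proj₁ iso) x)) →
                        IsKTupleRestrainedDomᵇ k H h → IsKTupleRestrainedDomᵇ k G s
restrainedᵇ-transport {k = k} G H (f , f-adj) {s} {h} s≡h∘f (dom , res) =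
  (λ x → ≤-trans (dom (to x)) (≤-reflexive (trans (sym (count-∘⤖ f _)) (count-cong (sym ∘ closed≡ x)))))
  , (λ x sx → ≤-trans (res (to x) (trans (sym (s≡h∘f x)) sx))
                      (≤-reflexive (trans (sym (count-∘⤖ f _)) (count-cong (sym ∘ open≡ x)))))
  where
  to = Bijection.to f
  closed≡ : ∀ x y → (closedAdj G x y ∧ s y) ≡ (closedAdj H (to x) (to y) ∧ h (to y))
  closed≡ x y = cong₂ _∧_ (cong₂ _∨_ (sym (does-≟-injective to (Bijection.injective f) x y)) (f-adj x y)) (s≡h∘f y)
  open≡ : ∀ x y → (adj G x y ∧ not (s y)) ≡ (adj H (to x) (to y) ∧ not (h (to y)))
  open≡ x y = cong₂ _∧_ (f-adj x y) (cong not (s≡h∘f y))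

restrainedᵇ-const-true : ∀ {k} (G : Graph n) → MinDeg≥ G (k ∸ 1) → IsKTupleRestrainedDomᵇ k G (const true)
restrainedᵇ-const-true {k = k} G δG = dom , λ _ ()
  where
  open ≤-Reasoning
  dom : ∀ x → k ≤ count (λ y → closedAdj G x y ∧ true)
  dom x = begin
    k                                     ≤⟨ m≤n+m∸n k 1 ⟩
    suc (k ∸ 1)                           ≤⟨ s≤s (δG x) ⟩
    suc (deg G x)                         ≡⟨ ∣N[x]∣≡1+deg G x ⟨
    count (closedAdj G x)                 ≡⟨ count-cong (λ y → ∧-identityʳ (closedAdj G x y)) ⟨
    count (λ y → closedAdj G x y ∧ true) ∎

comap : (Fin m → Fin n) → Graph n → Graph m
comap f G = record
  { adj    = λ x y → adj G (f x) (f y)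
  ; sym    = λ x y → Graph.sym G (f x) (f y)
  ; irrefl = λ x → irrefl G (f x)
  }

↑ˡ≢↑ʳ : (i : Fin a) (j : Fin b) → i ↑ˡ b ≢ a ↑ʳ j
↑ˡ≢↑ʳ {a} {b} i j eq with trans (sym (splitAt-↑ˡ a i b)) (trans (cong (splitAt a) eq) (splitAt-↑ʳ a b j))
... | ()

↑ˡ-↑ʳ-cases : (P : Fin (a + b) → Set) → (∀ i → P (i ↑ˡ b)) → (∀ j → P (a ↑ʳ j)) → ∀ w → P w
↑ˡ-↑ʳ-cases {a} P left right w with splitAt a w in eq
... | inj₁ i = subst P (splitAt⁻¹-↑ˡ eq) (left i)
... | inj₂ j = subst P (splitAt⁻¹-↑ʳ eq) (right j)

isRight : ∀ a → Fin (a + b) → Bool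
isRight a = isInj₂ᵇ ∘ splitAt a

isRight-↑ˡ : (i : Fin a) (b : ℕ) → isRight a (i ↑ˡ b) ≡ false
isRight-↑ˡ {a} i b = cong isInj₂ᵇ (splitAt-↑ˡ a i b)

isRight-↑ʳ : ∀ a (j : Fin b) → isRight a (a ↑ʳ j) ≡ true
isRight-↑ʳ {b} a j = cong isInj₂ᵇ (splitAt-↑ʳ a b j)

count-∧-isRight : ∀ a (q : Fin (a + b) → Bool) → count (λ w → q w ∧ isRight a w) ≡ count (q ∘ (a ↑ʳ_))
count-∧-isRight {b} a q = trans (count-+ a (λ w → q w ∧ isRight a w)) (cong₂ _+_
  (count-∀false _ (λ i → trans (cong (q (i ↑ˡ b) ∧_) (isRight-↑ˡ i b)) (∧-zeroʳ _)))
  (count-cong (λ j → trans (cong (q (a ↑ʳ j) ∧_) (isRight-↑ʳ a j)) (∧-identityʳ _))))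

count-∧-isLeft : ∀ a (q : Fin (a + b) → Bool) → count (λ w → q w ∧ not (isRight a w)) ≡ count (q ∘ (_↑ˡ b))
count-∧-isLeft {b} a q = trans (count-+ a (λ w → q w ∧ not (isRight a w))) (trans (cong₂ _+_
  (count-cong (λ i → trans (cong (λ r → q (i ↑ˡ b) ∧ not r) (isRight-↑ˡ i b)) (∧-identityʳ _)))
  (count-∀false _ (λ j → trans (cong (λ r → q (a ↑ʳ j) ∧ not r) (isRight-↑ʳ a j)) (∧-zeroʳ _))))
  (+-identityʳ _))

restrainedᵇ-isRight⇔kJoin : ∀ {k} a (J : Graph (a + b)) →
  IsKTupleRestrainedDomᵇ k J (isRight a) ⇔
  ((∀ i → k ≤ count (λ j → adj J (i ↑ˡ b) (a ↑ʳ j)))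
   × MinDeg≥ (comap (_↑ˡ b) J) k
   × MinDeg≥ (comap (a ↑ʳ_) J) (k ∸ 1))
restrainedᵇ-isRight⇔kJoin {b} {k} a J = mk⇔
  (λ (dom , res) →
      (λ i → ≤-trans (dom (i ↑ˡ b)) (≤-reflexive (cross≡ i)))
    , (λ i → ≤-trans (res (i ↑ˡ b) (isRight-↑ˡ i b)) (≤-reflexive (left≡ i)))
    , (λ j → ∸-monoˡ-≤ 1 (≤-trans (dom (a ↑ʳ j)) (≤-reflexive (right≡ j)))))
  (λ (cross , δleft , δright) →
      ↑ˡ-↑ʳ-cases _
        (λ i → ≤-trans (cross i) (≤-reflexive (sym (cross≡ i))))
        (λ j → ≤-trans (m≤n+m∸n k 1) (≤-trans (s≤s (δright j)) (≤-reflexive (sym (right≡ j)))))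
    , ↑ˡ-↑ʳ-cases _
        (λ i _ → ≤-trans (δleft i) (≤-reflexive (sym (left≡ i))))
        (λ j right≡false → contradiction (trans (sym (isRight-↑ʳ a j)) right≡false) λ ()))
  where
  cross≡ : ∀ i → count (λ w → closedAdj J (i ↑ˡ b) w ∧ isRight a w) ≡ count (λ j → adj J (i ↑ˡ b) (a ↑ʳ j))
  cross≡ i = trans (count-∧-isRight a (closedAdj J (i ↑ˡ b)))
    (count-cong (λ j → cong (_∨ adj J (i ↑ˡ b) (a ↑ʳ j)) (dec-false (i ↑ˡ b ≟ a ↑ʳ j) (↑ˡ≢↑ʳ i j))))

  right≡ : ∀ j → count (λ w → closedAdj J (a ↑ʳ j) w ∧ isRight a w) ≡ suc (deg (comap (a ↑ʳ_) J) j)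
  right≡ j = trans (count-∧-isRight a (closedAdj J (a ↑ʳ j)))
    (trans (count-cong (λ j' → cong (_∨ adj J (a ↑ʳ j) (a ↑ʳ j'))
                                    (does-≟-injective (a ↑ʳ_) (↑ʳ-injective a _ _) j j')))
           (∣N[x]∣≡1+deg (comap (a ↑ʳ_) J) j))

  left≡ : ∀ i → count (λ w → adj J (i ↑ˡ b) w ∧ not (isRight a w)) ≡ deg (comap (_↑ˡ b) J) i
  left≡ i = count-∧-isLeft a (adj J (i ↑ˡ b))

count-isRight : ∀ a → count (isRight {b} a) ≡ b
count-isRight a = trans (count-∧-isRight a (const true)) (count-∀true _ (λ _ → refl))

k≤∣S∣ : ∀ {k} (G : Graph n) {S : Subset n} → IsKTupleDom k G S → Fin n → k ≤ ∣ S ∣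
k≤∣S∣ G {S} dom x = ≤-trans (dom x) (∣p∩q∣≤∣q∣ (N[ G ] x) S)

restrainedDom-transport : ∀ {k m'} (G : Graph n) (H : Graph m) (iso : G ≅ H) {h : Fin m → Bool} →
                          IsKTupleRestrainedDomᵇ k H h → count h ≡ m' →
                          Σ[ S ∈ Subset n ] IsKTupleRestrainedDom k G S × ∣ S ∣ ≡ m'
restrainedDom-transport {k = k} G H iso {h} R count≡ =
  tabulate s
  , Equivalence.from (restrained⇔restrainedᵇ {k = k} G (tabulate s))
                     (restrainedᵇ-transport G H iso (lookup∘tabulate s) R)
  , trans (count-∘⤖ (proj₁ iso) h) count≡
  where
  s = h ∘ Bijection.to (proj₁ iso)

restrainedDom-of-joinProperty : ∀ {k m'} (G : Graph n) → JoinProperty k G m' →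
                                Σ[ S ∈ Subset n ] IsKTupleRestrainedDom k G S × ∣ S ∣ ≡ m'
restrainedDom-of-joinProperty G (inj₁ (K' , δK' , G≅K')) =
  restrainedDom-transport G K' G≅K' (restrainedᵇ-const-true K' δK') (count-∀true _ (λ _ → refl))
restrainedDom-of-joinProperty {k = k} G (inj₂ (a , F , K' , J , δF , δK' , (_ , J↾F , J↾K' , cross) , G≅J)) =
  restrainedDom-transport G J G≅J
    (Equivalence.from (restrainedᵇ-isRight⇔kJoin {k = k} a J)
      (cross , MinDeg≥-cong (comap (_↑ˡ _) J) F J↾F δF , MinDeg≥-cong (comap (a ↑ʳ_) J) K' J↾K' δK'))
    (count-isRight a)

joinProperty-of-restrainedDom : ∀ {k} (G : Graph n) (S : Subset n) → Fin n →
                                IsKTupleRestrainedDom k G S → JoinProperty k G ∣ S ∣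
joinProperty-of-restrainedDom {n = n} {k = k} G S x₀ R =
  asJoin (Equivalence.to (restrainedᵇ-isRight⇔kJoin {k = k} l J) isRight-restrained)
  where
  l = ∣ ∁ S ∣
  r = ∣ S ∣
  φ : Fin n ↔ Fin (l + r)
  φ = ↔-trans (partition S) (↔-sym +↔⊎)
  open Inverse φ using (from; strictlyInverseˡ; strictlyInverseʳ)

  J : Graph (l + r)
  J = comap from G

  G≅J : G ≅ J
  G≅J = ↔⇒⤖ φ , λ x y → sym (cong₂ (adj G) (strictlyInverseʳ x) (strictlyInverseʳ y))

  J≅G : J ≅ G
  J≅G = ↔⇒⤖ (↔-sym φ) , λ _ _ → refl

  isRight≡S∘from : ∀ w → isRight l w ≡ lookup S (from w)
  isRight≡S∘from w = begin
    isRight l w                                   ≡⟨ cong (isRight l) (strictlyInverseˡ w) ⟨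
    isRight l (join l r (separate S (from w)))   ≡⟨ cong isInj₂ᵇ (splitAt-join l r (separate S (from w))) ⟩
    isInj₂ᵇ (separate S (from w))                ≡⟨ isInj₂ᵇ∘separate S (from w) ⟩
    lookup S (from w)                             ∎
    where open ≡-Reasoning

  isRight-restrained : IsKTupleRestrainedDomᵇ k J (isRight l)
  isRight-restrained =
    restrainedᵇ-transport J G J≅G isRight≡S∘from (Equivalence.to (restrained⇔restrainedᵇ {k = k} G S) R)

  asJoin : (∀ i → k ≤ count (λ j → adj J (i ↑ˡ r) (l ↑ʳ j)))
           × MinDeg≥ (comap (_↑ˡ r) J) k × MinDeg≥ (comap (l ↑ʳ_) J) (k ∸ 1) →
           JoinProperty k G r
  asJoin (cross , δleft , δright) =
    inj₂ (l , comap (_↑ˡ r) J , comap (l ↑ʳ_) J , J , δleft , δright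
         , (k≤∣S∣ G (proj₁ R) x₀ , (λ _ _ → refl) , (λ _ _ → refl) , cross) , G≅J)

theorem3p1 : (k : ℕ) → 2 ≤ k → {n : ℕ} → (G : Graph n) → MinDeg≥ G (k ∸ 1)
    → (m : ℕ) → k ≤ m
    → (γr×[ k ] G ≡ m) ⇔ IsLeastPositive (JoinProperty k G) m
theorem3p1 k k≥2 {n} G _ m k≤m = mk⇔ γ≡m⇒least least⇒γ≡m
  where
  0<k : 0 < k
  0<k = ≤-trans (s≤s z≤n) k≥2

  vertex : (S : Subset n) → ∣ S ∣ ≡ m → Fin n
  vertex S ∣S∣≡m = fromℕ< (<-≤-trans (≤-trans 0<k k≤m) (subst (_≤ n) ∣S∣≡m (∣p∣≤n S)))

  γ≡m⇒least : γr×[ k ] G ≡ m → IsLeastPositive (JoinProperty k G) m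
  γ≡m⇒least ((S , R , ∣S∣≡m) , minimal) =
      ≤-trans 0<k k≤m
    , subst (JoinProperty k G) ∣S∣≡m (joinProperty-of-restrainedDom G S (vertex S ∣S∣≡m) R)
    , λ m' _ P → let (S' , R' , ∣S'∣≡m') = restrainedDom-of-joinProperty G P
                 in ≤-trans (minimal S' R') (≤-reflexive ∣S'∣≡m')

  least⇒γ≡m : IsLeastPositive (JoinProperty k G) m → γr×[ k ] G ≡ m
  least⇒γ≡m (_ , P , least) =
    let (S , R , ∣S∣≡m) = restrainedDom-of-joinProperty G P
        x₀ = vertex S ∣S∣≡m
    in (S , R , ∣S∣≡m)
     , λ S' R' → least ∣ S' ∣ (≤-trans 0<k (k≤∣S∣ G (proj₁ R') x₀)) (joinProperty-of-restrainedDom G S' x₀ R')
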